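{- For each $n\ge1$, $\mathcal{P}_{n+1}$ is properly included in $\mathcal{P}_n$.
   Context: All alphabets are finite. A prefixal factorization of an infinite word $x$ is a factorization $x=V_0V_1\cdots$ with every $V_i$ a non-empty prefix of $x$. A finite non-empty word is unbordered if no non-empty word other than itself is both a prefix and a suffix of it; $UP(x)$ is the set of non-empty unbordered prefixes of $x$. $\mathcal{P}_1$ is the set of infinite words (over any finite alphabet) admitting a prefixal factorization; each $x\in\mathcal{P}_1$ has a unique factorization $x=U_0U_1\cdots$ with $U_i\in UP(x)$. With $UP'(x)=\{U_i:i\ge0\}$, $n_x=\mathrm{card}(UP'(x))$, $UP'(x)$ ordered by index of first occurrence in this factorization, and $\phi:\{1,\dots,n_x\}\to UP'(x)$ the order-preserving bijection, the derived word is $\delta(x)=\phi^{ -1}(U_0)\phi^{ -1}(U_1)\cdots\in\{1,\dots,n_x\}^\omega$. Define recursively $\mathcal{P}_{n+1}=\{x\in\mathcal{P}_n:\delta(x)\in\mathcal{P}_n\}$. -}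

module Defs where

open import Data.Nat using (ℕ; zero; suc; _+_; _∸_; _<_; _≤_)
open import Data.Fin using (Fin; toℕ)
open import Data.Product using (Σ; ∃; _×_; _,_)
open import Data.Empty using (⊥)
open import Relation.Nullary using (¬_)
open import Relation.Binary.PropositionalEquality using (_≡_)
open import Function.Bundles using (_⇔_)

Word : ℕ → Set
Word k = ℕ → Fin k

FactorIsPrefix : {k : ℕ} → Word k → (a L : ℕ) → Set
FactorIsPrefix x a L = ∀ j → j < L → x (a + j) ≡ x j

-- A factorization x = V₀ V₁ ⋯ given by cut positions p 0 = 0 < p 1 < p 2 < ⋯ ;
-- V i = x[p i .. p (suc i)), of length len p i.
len : (ℕ → ℕ) → ℕ → ℕ
len p i = p (suc i) ∸ p i

IsCutSequence : (ℕ → ℕ) → Set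
IsCutSequence p = (p 0 ≡ 0) × (∀ i → p i < p (suc i))

IsPrefixalFactorization : {k : ℕ} → Word k → (ℕ → ℕ) → Set
IsPrefixalFactorization x p =
  IsCutSequence p × (∀ i → FactorIsPrefix x (p i) (len p i))

UnborderedPrefix : {k : ℕ} → Word k → ℕ → Set
UnborderedPrefix x L =
  (1 ≤ L) × (∀ b → 1 ≤ b → b < L → ¬ (∀ j → j < b → x j ≡ x ((L ∸ b) + j)))

IsUPFactorization : {k : ℕ} → Word k → (ℕ → ℕ) → Set
IsUPFactorization x p =
  IsPrefixalFactorization x p × (∀ i → UnborderedPrefix x (len p i))

P1 : {k : ℕ} → Word k → Set
P1 x = ∃ λ p → IsPrefixalFactorization x p

-- Derived x m y : y ∈ (Fin m)^ω is the derived word δ(x) (with n_x = m),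
-- letters 1..n_x renamed to 0..n_x-1.  Prefixes of x are determined by their
-- lengths, so U i = U j iff len p i = len p j.
--  * y i = y j  iff  U i = U j       (y codes the factors injectively)
--  * every letter of Fin m occurs in y (so m = card UP'(x))
--  * letters are numbered in order of first occurrence:
--    any letter c smaller than y i already occurred before position i.
Derived : {k : ℕ} → Word k → (m : ℕ) → Word m → Set
Derived x m y = ∃ λ p →
  IsUPFactorization x p
  × (∀ i j → (y i ≡ y j) ⇔ (len p i ≡ len p j))
  × (∀ (c : Fin m) → ∃ λ i → y i ≡ c)
  × (∀ i (c : Fin m) → toℕ c < toℕ (y i) → ∃ λ j → j < i × y j ≡ c)

-- 𝒫 n for n ≥ 1 (𝒫 0 is an unused dummy, empty).
𝒫 : ℕ → {k : ℕ} → Word k → Set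
𝒫 zero x = ⊥
𝒫 (suc zero) x = P1 x
𝒫 (suc (suc n)) x =
  𝒫 (suc n) x × (∃ λ m → Σ (Word m) λ y → Derived x m y × 𝒫 (suc n) y)

-- The Fibonacci morphism φ : 0 ↦ 01, 1 ↦ 0 sends a binary word y starting
-- with 01 to a word that starts with 01 and has no factor 11, so its only
-- unbordered prefixes are 0 and 01. Its factorization into unbordered prefixes
-- is therefore the factorization into the blocks φ(y i), and its derived word
-- is y up to renaming of letters. Since every 𝒫 n is invariant under such
-- renamings, φ(y) ∈ 𝒫 (n+1) iff y ∈ 𝒫 n, and by induction from 01^ω ∉ 𝒫 1 the
-- word φⁿ(01^ω) lies in 𝒫 n but not in 𝒫 (n+1).
module Submission where

open import Defs
open import Data.Nat using (ℕ; zero; suc; _+_; _∸_; _<_; _≤_; z≤n; s≤s)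
open import Data.Nat.Properties
  using (+-identityʳ; +-assoc; +-comm; m+[n∸m]≡n; m+n∸m≡n; m<m+n; m<n⇒0<n∸m; <⇒≤; <⇒≱; n≮0)
open import Data.Fin using (Fin; toℕ; opposite)
open import Data.Fin.Properties using (toℕ≤pred[n])
open import Data.Product using (Σ; ∃; _×_; _,_; proj₁; proj₂)
open import Data.Sum using (_⊎_; inj₁; inj₂)
open import Data.Empty using (⊥-elim)
open import Relation.Nullary using (¬_; contradiction)
open import Relation.Binary.PropositionalEquality
  using (_≡_; _≢_; refl; sym; trans; cong; cong₂; subst; module ≡-Reasoning)
open import Function.Base using (_∘′_)
open import Function.Bundles using (_⇔_; mk⇔; Equivalence)
open import Function.Construct.Composition using (_⇔-∘_)
open import Function.Construct.Symmetry using (⇔-sym)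

pattern 𝟎 = Fin.zero
pattern 𝟏 = Fin.suc Fin.zero

tail : {k : ℕ} → Word k → Word k
tail x t = x (suc t)

drop : {k : ℕ} → ℕ → Word k → Word k
drop i x t = x (i + t)

cut-suc : ∀ {p} → IsCutSequence p → ∀ i → p (suc i) ≡ p i + len p i
cut-suc (_ , p<) i = sym (m+[n∸m]≡n (<⇒≤ (p< i)))

factor-head : ∀ {k} {x : Word k} {p} → IsPrefixalFactorization x p → ∀ i → x (p i) ≡ x 0
factor-head {x = x} {p} ((_ , p<) , prefix) i =
  subst (λ a → x a ≡ x 0) (+-identityʳ (p i)) (prefix i 0 (m<n⇒0<n∸m (p< i)))

derived⇒P1 : ∀ {k m} {x : Word k} {y : Word m} → Derived x m y → P1 x
derived⇒P1 (p , (prefixal , _) , _) = p , prefixal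

𝒫-suc⊆𝒫 : ∀ n {k} {x : Word k} → 𝒫 (suc (suc n)) x → 𝒫 (suc n) x
𝒫-suc⊆𝒫 n = proj₁

derived-𝒫 : ∀ n {k m} {x : Word k} {y : Word m} →
            Derived x m y → 𝒫 (suc n) y → 𝒫 (suc (suc n)) x
derived-𝒫 zero    d y∈𝒫 = derived⇒P1 d , _ , _ , d , y∈𝒫
derived-𝒫 (suc n) d y∈𝒫 = derived-𝒫 n d (𝒫-suc⊆𝒫 n y∈𝒫) , _ , _ , d , y∈𝒫

SamePattern : {k k′ : ℕ} → Word k → Word k′ → Set
SamePattern x x′ = ∀ i j → (x i ≡ x j) ⇔ (x′ i ≡ x′ j)

module _ {k k′ : ℕ} {x : Word k} {x′ : Word k′} (same : SamePattern x x′) where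

  factorIsPrefix-pattern : ∀ a L → FactorIsPrefix x a L → FactorIsPrefix x′ a L
  factorIsPrefix-pattern a L prefix j j<L = Equivalence.to (same (a + j) j) (prefix j j<L)

  unborderedPrefix-pattern : ∀ L → UnborderedPrefix x L → UnborderedPrefix x′ L
  unborderedPrefix-pattern L (1≤L , unbordered) = 1≤L , λ b 1≤b b<L border →
    unbordered b 1≤b b<L (λ j j<b → Equivalence.from (same j (L ∸ b + j)) (border j j<b))

  prefixalFactorization-pattern : ∀ p → IsPrefixalFactorization x p → IsPrefixalFactorization x′ p
  prefixalFactorization-pattern p (cut , prefix) =
    cut , λ i → factorIsPrefix-pattern (p i) (len p i) (prefix i)

  upFactorization-pattern : ∀ p → IsUPFactorization x p → IsUPFactorization x′ p
  upFactorization-pattern p (prefixal , unbordered) =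
    prefixalFactorization-pattern p prefixal ,
    λ i → unborderedPrefix-pattern (len p i) (unbordered i)

  derived-pattern : ∀ m y → Derived x m y → Derived x′ m y
  derived-pattern m y (p , up , rest) = p , upFactorization-pattern p up , rest

𝒫-pattern : ∀ n {k k′} {x : Word k} {x′ : Word k′} → SamePattern x x′ → 𝒫 n x → 𝒫 n x′
𝒫-pattern (suc zero)    same (p , prefixal) = p , prefixalFactorization-pattern same p prefixal
𝒫-pattern (suc (suc n)) same (x∈𝒫 , m , y , d , y∈𝒫) =
  𝒫-pattern (suc n) same x∈𝒫 , m , y , derived-pattern same m y d , y∈𝒫

UniqueUPFactorization : {k : ℕ} → Word k → Set
UniqueUPFactorization x =
  ∀ {p q} → IsUPFactorization x p → IsUPFactorization x q → ∀ i → p i ≡ q i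

-- Both derived words have the equality pattern of the factor lengths.
derived-samePattern : ∀ {k m m′} {x : Word k} {y : Word m} {y′ : Word m′} →
                      UniqueUPFactorization x → Derived x m y → Derived x m′ y′ → SamePattern y y′
derived-samePattern unique (p , up , y-codes , _) (q , uq , y′-codes , _) i j =
  ⇔-sym (y′-codes i j) ⇔-∘ (same-lengths ⇔-∘ y-codes i j)
  where
  len-unique : ∀ i → len p i ≡ len q i
  len-unique i = cong₂ _∸_ (unique up uq (suc i)) (unique up uq i)

  same-lengths : (len p i ≡ len p j) ⇔ (len q i ≡ len q j)
  same-lengths = mk⇔ (λ e → trans (sym (len-unique i)) (trans e (len-unique j)))
                     (λ e → trans (len-unique i) (trans e (sym (len-unique j))))

unbordered-1 : ∀ {k} (x : Word k) → UnborderedPrefix x 1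
unbordered-1 x = s≤s z≤n , λ { b (s≤s z≤n) (s≤s ()) }

unbordered-2 : ∀ {k} (x : Word k) → x 0 ≢ x 1 → UnborderedPrefix x 2
unbordered-2 x x0≢x1 = s≤s z≤n , λ
  { (suc zero)    _ _                   border → x0≢x1 (border 0 (s≤s z≤n))
  ; (suc (suc b)) _ (s≤s (s≤s ())) _ }

Starts01 : Word 2 → Set
Starts01 x = (x 0 ≡ 𝟎) × (x 1 ≡ 𝟏)

No11 : Word 2 → Set
No11 x = ∀ t → x t ≡ 𝟏 → x (suc t) ≡ 𝟎

-- A longer prefix ends in 0 or in 01, both of which are borders.
unbordered-length : (x : Word 2) → Starts01 x → No11 x →
                    ∀ L → UnborderedPrefix x L → L ≡ 1 ⊎ L ≡ 2
unbordered-length x _ _ (suc zero)       _ = inj₁ refl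
unbordered-length x _ _ (suc (suc zero)) _ = inj₂ refl
unbordered-length x (x0 , x1) no11 (suc (suc (suc n))) (_ , unbordered)
  with x (suc (suc n)) in last
... | 𝟎 = ⊥-elim (unbordered 1 (s≤s z≤n) (s≤s (s≤s z≤n)) border)
  where
  border : ∀ j → j < 1 → x j ≡ x (suc (suc n) + j)
  border zero    _        = trans x0 (sym (trans (cong x (+-identityʳ _)) last))
  border (suc j) (s≤s ())
... | 𝟏 with x (suc n) in previous
...   | 𝟏 = contradiction (trans (sym (no11 (suc n) previous)) last) λ ()
...   | 𝟎 = ⊥-elim (unbordered 2 (s≤s z≤n) (s≤s (s≤s (s≤s z≤n))) border)
  where
  border : ∀ j → j < 2 → x j ≡ x (suc n + j)
  border zero          _              = trans x0 (sym (trans (cong x (+-identityʳ _)) previous))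
  border (suc zero)    _              = trans x1 (sym (trans (cong x (+-comm (suc n) 1)) last))
  border (suc (suc j)) (s≤s (s≤s ()))

mutual
  fib : Word 2 → Word 2
  fib y t = fibFrom (y 0) (tail y) t

  fibFrom : Fin 2 → Word 2 → Word 2
  fibFrom 𝟎 ys zero          = 𝟎
  fibFrom 𝟎 ys (suc zero)    = 𝟏
  fibFrom 𝟎 ys (suc (suc t)) = fib ys t
  fibFrom 𝟏 ys zero          = 𝟎
  fibFrom 𝟏 ys (suc t)       = fib ys t

fibLength : Fin 2 → ℕ
fibLength 𝟎 = 2
fibLength 𝟏 = 1

fibLength-injective : ∀ c d → fibLength c ≡ fibLength d → c ≡ d
fibLength-injective 𝟎 𝟎 _ = refl
fibLength-injective 𝟎 𝟏 ()
fibLength-injective 𝟏 𝟎 ()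
fibLength-injective 𝟏 𝟏 _ = refl

fibFrom-fibLength : ∀ c ys t → fibFrom c ys (fibLength c + t) ≡ fib ys t
fibFrom-fibLength 𝟎 ys t = refl
fibFrom-fibLength 𝟏 ys t = refl

fib-0 : ∀ y → fib y 0 ≡ 𝟎
fib-0 y with y 0
... | 𝟎 = refl
... | 𝟏 = refl

fib-1 : ∀ y → fib y 1 ≡ opposite (y 0)
fib-1 y with y 0
... | 𝟎 = refl
... | 𝟏 = fib-0 (tail y)

fib-starts01 : ∀ y → y 0 ≡ 𝟎 → Starts01 (fib y)
fib-starts01 y y0 = fib-0 y , trans (fib-1 y) (cong opposite y0)

mutual
  fib-no11 : ∀ y → No11 (fib y)
  fib-no11 y = fibFrom-no11 (y 0) (tail y)

  fibFrom-no11 : ∀ c ys → No11 (fibFrom c ys)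
  fibFrom-no11 𝟎 ys (suc zero)    _ = fib-0 ys
  fibFrom-no11 𝟎 ys (suc (suc t)) e = fib-no11 ys t e
  fibFrom-no11 𝟏 ys (suc t)       e = fib-no11 ys t e

fibCuts : Word 2 → ℕ → ℕ
fibCuts y zero    = 0
fibCuts y (suc i) = fibLength (y 0) + fibCuts (tail y) i

fibCuts-suc : ∀ y i → fibCuts y (suc i) ≡ fibCuts y i + fibLength (y i)
fibCuts-suc y zero    = +-identityʳ (fibLength (y 0))
fibCuts-suc y (suc i) = begin
  fibLength (y 0) + fibCuts (tail y) (suc i)
    ≡⟨ cong (fibLength (y 0) +_) (fibCuts-suc (tail y) i) ⟩
  fibLength (y 0) + (fibCuts (tail y) i + fibLength (y (suc i)))
    ≡⟨ sym (+-assoc (fibLength (y 0)) _ _) ⟩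
  fibCuts y (suc i) + fibLength (y (suc i))
    ∎
  where open ≡-Reasoning

len-fibCuts : ∀ y i → len (fibCuts y) i ≡ fibLength (y i)
len-fibCuts y i = trans (cong (_∸ fibCuts y i) (fibCuts-suc y i)) (m+n∸m≡n (fibCuts y i) _)

fibCuts-isCutSequence : ∀ y → IsCutSequence (fibCuts y)
fibCuts-isCutSequence y = refl , λ i →
  subst (fibCuts y i <_) (sym (fibCuts-suc y i)) (m<m+n (fibCuts y i) (fibLength-positive (y i)))
  where
  fibLength-positive : ∀ c → 0 < fibLength c
  fibLength-positive 𝟎 = s≤s z≤n
  fibLength-positive 𝟏 = s≤s z≤n

fib-drop : ∀ y i t → fib y (fibCuts y i + t) ≡ fib (drop i y) t
fib-drop y zero    t = refl
fib-drop y (suc i) t = begin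
  fib y ((fibLength (y 0) + fibCuts (tail y) i) + t) ≡⟨ cong (fib y) (+-assoc (fibLength (y 0)) _ t) ⟩
  fibFrom (y 0) (tail y) (fibLength (y 0) + (fibCuts (tail y) i + t))
                                                     ≡⟨ fibFrom-fibLength (y 0) (tail y) _ ⟩
  fib (tail y) (fibCuts (tail y) i + t)              ≡⟨ fib-drop (tail y) i t ⟩
  fib (drop (suc i) y) t                             ∎
  where open ≡-Reasoning

fib-at-cut : ∀ y i → fib y (fibCuts y i + 0) ≡ 𝟎
fib-at-cut y i = trans (fib-drop y i 0) (fib-0 (drop i y))

fib-after-cut : ∀ y i → fib y (fibCuts y i + 1) ≡ opposite (y i)
fib-after-cut y i =
  trans (fib-drop y i 1) (trans (fib-1 (drop i y)) (cong (opposite ∘′ y) (+-identityʳ i)))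

module FibFactorization (y : Word 2) (y0 : y 0 ≡ 𝟎) where

  private
    x : Word 2
    x = fib y

    x0 : x 0 ≡ 𝟎
    x0 = proj₁ (fib-starts01 y y0)

    x1 : x 1 ≡ 𝟏
    x1 = proj₂ (fib-starts01 y y0)

  fibCuts-isUPFactorization : IsUPFactorization x (fibCuts y)
  fibCuts-isUPFactorization =
    (fibCuts-isCutSequence y , factorIsPrefix) ,
    λ i → subst (UnborderedPrefix x) (sym (len-fibCuts y i)) (image-unbordered (y i))
    where
    image-prefix : ∀ i c → y i ≡ c → ∀ j → j < fibLength c → x (fibCuts y i + j) ≡ x j
    image-prefix i c   _    zero          _              = trans (fib-at-cut y i) (sym x0)
    image-prefix i 𝟎 yi≡𝟎 (suc zero)    _              =
      trans (fib-after-cut y i) (trans (cong opposite yi≡𝟎) (sym x1))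
    image-prefix i 𝟎   _    (suc (suc j)) (s≤s (s≤s ()))
    image-prefix i 𝟏   _    (suc j)       (s≤s ())

    factorIsPrefix : ∀ i → FactorIsPrefix x (fibCuts y i) (len (fibCuts y) i)
    factorIsPrefix i j j<len = image-prefix i (y i) refl j (subst (j <_) (len-fibCuts y i) j<len)

    image-unbordered : ∀ c → UnborderedPrefix x (fibLength c)
    image-unbordered 𝟎 = unbordered-2 x (λ x0≡x1 → contradiction (trans (sym x0) (trans x0≡x1 x1)) λ ())
    image-unbordered 𝟏 = unbordered-1 x

  -- The second letter of a factor is 1 exactly when the factor is the prefix 01.
  fibCuts-unique : ∀ {p} → IsUPFactorization x p → ∀ i → p i ≡ fibCuts y i
  fibCuts-unique ((cut , _) , _) zero = proj₁ cut
  fibCuts-unique {p} up@(prefixal@(cut , prefix) , unbordered) (suc i) = begin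
    p (suc i)                     ≡⟨ cut-suc cut i ⟩
    p i + len p i                 ≡⟨ cong₂ _+_ p≡cuts factor-length ⟩
    fibCuts y i + fibLength (y i) ≡⟨ sym (fibCuts-suc y i) ⟩
    fibCuts y (suc i)             ∎
    where
    open ≡-Reasoning

    p≡cuts : p i ≡ fibCuts y i
    p≡cuts = fibCuts-unique up i

    second-letter : x (p i + 1) ≡ opposite (y i)
    second-letter = trans (cong (λ a → x (a + 1)) p≡cuts) (fib-after-cut y i)

    factor-length : len p i ≡ fibLength (y i)
    factor-length with unbordered-length x (x0 , x1) (fib-no11 y) (len p i) (unbordered i) | y i in yi
    ... | inj₁ len≡1 | 𝟏 = len≡1
    ... | inj₂ len≡2 | 𝟎 = len≡2
    ... | inj₁ len≡1 | 𝟎 = contradiction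
      (begin
        𝟏                   ≡⟨ cong opposite (sym yi) ⟩
        opposite (y i)      ≡⟨ sym second-letter ⟩
        x (p i + 1)         ≡⟨ cong (λ l → x (p i + l)) (sym len≡1) ⟩
        x (p i + len p i)   ≡⟨ cong x (sym (cut-suc cut i)) ⟩
        x (p (suc i))       ≡⟨ factor-head prefixal (suc i) ⟩
        x 0                 ≡⟨ x0 ⟩
        𝟎                   ∎) λ ()
    ... | inj₂ len≡2 | 𝟏 = contradiction
      (begin
        𝟎                   ≡⟨ cong opposite (sym yi) ⟩
        opposite (y i)      ≡⟨ sym second-letter ⟩
        x (p i + 1)         ≡⟨ prefix i 1 (subst (1 <_) (sym len≡2) (s≤s (s≤s z≤n))) ⟩
        x 1                 ≡⟨ x1 ⟩
        𝟏                   ∎) λ ()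

  fib-uniqueUPFactorization : UniqueUPFactorization x
  fib-uniqueUPFactorization up uq i = trans (fibCuts-unique up i) (sym (fibCuts-unique uq i))

  fib-derived : y 1 ≡ 𝟏 → Derived x 2 y
  fib-derived y1 =
    fibCuts y , fibCuts-isUPFactorization , codes , occurs , first-occurrence
    where
    codes : ∀ i j → (y i ≡ y j) ⇔ (len (fibCuts y) i ≡ len (fibCuts y) j)
    codes i j = mk⇔
      (λ e → trans (len-fibCuts y i) (trans (cong fibLength e) (sym (len-fibCuts y j))))
      (λ e → fibLength-injective (y i) (y j)
               (trans (sym (len-fibCuts y i)) (trans e (len-fibCuts y j))))

    occurs : ∀ c → ∃ λ i → y i ≡ c
    occurs 𝟎 = 0 , y0
    occurs 𝟏 = 1 , y1

    first-occurrence : ∀ i c → toℕ c < toℕ (y i) → ∃ λ j → j < i × y j ≡ c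
    first-occurrence zero    c lt = ⊥-elim (n≮0 (subst (λ d → toℕ c < toℕ d) y0 lt))
    first-occurrence (suc i) 𝟎 _  = 0 , s≤s z≤n , y0
    first-occurrence (suc i) 𝟏 lt = ⊥-elim (<⇒≱ lt (toℕ≤pred[n] (y (suc i))))

open FibFactorization using (fib-uniqueUPFactorization; fib-derived)

fibWord : ℕ → Word 2
fibWord zero    = λ { zero → 𝟎 ; (suc _) → 𝟏 }
fibWord (suc n) = fib (fibWord n)

fibWord-starts01 : ∀ n → Starts01 (fibWord n)
fibWord-starts01 zero    = refl , refl
fibWord-starts01 (suc n) = fib-starts01 (fibWord n) (proj₁ (fibWord-starts01 n))

fibWord-derived : ∀ n → Derived (fibWord (suc n)) 2 (fibWord n)
fibWord-derived n =
  fib-derived (fibWord n) (proj₁ (fibWord-starts01 n)) (proj₂ (fibWord-starts01 n))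

fibWord-∈-𝒫 : ∀ n → 𝒫 (suc n) (fibWord (suc n))
fibWord-∈-𝒫 zero    = derived⇒P1 (fibWord-derived 0)
fibWord-∈-𝒫 (suc n) = derived-𝒫 n (fibWord-derived (suc n)) (fibWord-∈-𝒫 n)

fibWord-∉-𝒫 : ∀ n → ¬ 𝒫 (suc n) (fibWord n)
fibWord-∉-𝒫 zero (p , prefixal@((p0 , p<) , _)) =
  contradiction (factor-head prefixal 1) (later-letter≢𝟎 (p 1) (subst (_< p 1) p0 (p< 0)))
  where
  later-letter≢𝟎 : ∀ t → 0 < t → fibWord 0 t ≢ 𝟎
  later-letter≢𝟎 (suc t) _ ()
fibWord-∉-𝒫 (suc n) (_ , _ , y , y-derived , y∈𝒫) =
  fibWord-∉-𝒫 n (𝒫-pattern (suc n) same y∈𝒫)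
  where
  same : SamePattern y (fibWord n)
  same = derived-samePattern (fib-uniqueUPFactorization (fibWord n) (proj₁ (fibWord-starts01 n)))
                             y-derived (fibWord-derived n)

mainTheorem4 : (n : ℕ) → 1 ≤ n →
    ((k : ℕ) (x : Word k) → 𝒫 (suc n) x → 𝒫 n x)
    × (∃ λ k → Σ (Word k) λ x → 𝒫 n x × ¬ 𝒫 (suc n) x)
mainTheorem4 (suc n) _ =
  (λ _ _ → 𝒫-suc⊆𝒫 n) , 2 , fibWord (suc n) , fibWord-∈-𝒫 n , fibWord-∉-𝒫 (suc n)
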